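{- Let $(D,T,L)$ be a triple and $x\in\mathrm{Leaf}(T)\setminus L$, and suppose $\mathrm{ML}(D,T,L\cup\{x\})\ge 1$. Then: (i) if $|\mathrm{Leaf}(T^{\mathrm{root}}(x))|\ge 2$, then $\mathrm{ML}(D,T,L)=\max\{\mathrm{ML}(D,T,L\cup\{x\}),\ \mathrm{ML}(D,T\cup T^{\mathrm{root}}(x),L)\}$; (ii) if $|\mathrm{Leaf}(T^{\mathrm{root}}(x))|=1$, then $\mathrm{ML}(D,T,L)=\mathrm{ML}(D,T,L\cup\{x\})$.
   Context: An out-tree of a digraph $D$ is a subgraph $T$ that is an oriented tree with exactly one vertex of in-degree zero (its root); its leaves are its vertices of out-degree zero in $T$ (a one-vertex out-tree has its root as its unique leaf). $\mathrm{Leaf}(T)$ is the set of leaves and $\mathrm{Int}(T)=V(T)\setminus\mathrm{Leaf}(T)$. An out-branching is a spanning out-tree. A triple $(D,T,L)$ consists of a digraph $D$, an out-tree $T$ of $D$ and a set $L\subseteq V(D)\setminus\mathrm{Int}(T)$. A $(T,L)$-out-branching of $D$ is an out-branching $T'$ of $D$ with $A(T)\subseteq A(T')$, every vertex of $L$ a leaf of $T'$, and the same root as $T$; $\mathrm{ML}(D,T,L)$ is the maximum number of leaves of a $(T,L)$-out-branching of $D$, and $0$ if none exists. $\hat D(T,L)$ is the subgraph of $D$ obtained by deleting all arcs leaving vertices of $L$ and all arcs not in $A(T)$ whose head lies in $V(T)$. For a subgraph $H$, $A^+_H(x)$ is the set of arcs of $H$ leaving $x$. $T\cup F$ denotes the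 subgraph with arc set $A(T)\cup F$ and all incident vertices (for an out-tree $F$, use its arc set). For a triple $(D,T,L)$ and $x\in \mathrm{Leaf}(T)\setminus L$, $T^{\mathrm{root}}(x)$ is defined by: set $x':=x$; while $x'$ has exactly one out-neighbour $y$ in $\hat D(T,L)$ (recomputed for the current $T$), add the arc $x'y$ to $T$ and set $x':=y$; then add all arcs of $A^+_{\hat D(T,L)}(x')$ to $T$. $T^{\mathrm{root}}(x)$ is the out-tree rooted at $x$ formed by exactly the arcs added in this process (i.e. the maximal subtree rooted at $x$ of the resulting tree). -}

module Defs where

open import Data.Nat using (ℕ; zero; suc; _+_)
open import Data.Fin using (Fin; zero; suc; _≟_)
open import Data.Bool using (Bool; true; false; _∧_; _∨_; not; if_then_else_)
open import Data.Maybe using (Maybe; just; nothing)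
import Data.Maybe as Maybe
open import Data.Product using (Σ; _×_)
open import Data.Sum using (_⊎_)
open import Relation.Nullary using (¬_)
open import Relation.Nullary.Decidable using (⌊_⌋)
open import Relation.Binary.PropositionalEquality using (_≡_)
open import Data.Nat using (_≤_)

count : ∀ {n} → (Fin n → Bool) → ℕ
count {zero}  f = 0
count {suc n} f = (if f zero then 1 else 0) + count (λ i → f (suc i))

anyF : ∀ {n} → (Fin n → Bool) → Bool
anyF {zero}  f = false
anyF {suc n} f = f zero ∨ anyF (λ i → f (suc i))

first : ∀ {n} → (Fin n → Bool) → Maybe (Fin n)
first {zero}  f = nothing
first {suc n} f = if f zero then just zero else Maybe.map suc (first (λ i → f (suc i)))

_==_ : ∀ {n} → Fin n → Fin n → Bool
i == j = ⌊ i ≟ j ⌋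

Arcs : ℕ → Set
Arcs n = Fin n → Fin n → Bool

Digraph : ℕ → Set
Digraph = Arcs

VSet : ℕ → Set
VSet n = Fin n → Bool

_∪A_ : ∀ {n} → Arcs n → Arcs n → Arcs n
(A ∪A B) u v = A u v ∨ B u v

_∪｛_｝ : ∀ {n} → VSet n → Fin n → VSet n
(L ∪｛ x ｝) v = L v ∨ (v == x)

-- A rooted subgraph (r , A) of an out-tree form: its vertex set is the root
-- together with all heads of arcs of A (tails are forced into it by IsOutTree).
inV : ∀ {n} → Fin n → Arcs n → Fin n → Bool
inV r A v = (v == r) ∨ anyF (λ u → A u v)

isLeaf : ∀ {n} → Fin n → Arcs n → Fin n → Bool
isLeaf r A v = inV r A v ∧ not (anyF (A v))

leafCount : ∀ {n} → Fin n → Arcs n → ℕ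
leafCount r A = count (isLeaf r A)

data Reach {n} (A : Arcs n) (r : Fin n) : Fin n → Set where
  here : Reach A r r
  step : ∀ {u v} → Reach A r u → A u v ≡ true → Reach A r v

-- (r , A) is an out-tree of D rooted at r:
-- its arcs are arcs of D, the root has in-degree 0, every other vertex
-- has in-degree exactly 1, and every vertex is reachable from the root
-- (so the underlying graph is a tree and r is its only in-degree-0 vertex).
record IsOutTree {n} (D : Digraph n) (r : Fin n) (A : Arcs n) : Set where
  field
    sub       : ∀ u v → A u v ≡ true → D u v ≡ true
    root-in   : ∀ u → A u r ≡ false
    in-unique : ∀ u u' v → A u v ≡ true → A u' v ≡ true → u ≡ u'
    reach     : ∀ u v → A u v ≡ true → Reach A r u

IsTLBranching : ∀ {n} → Digraph n → Fin n → Arcs n → VSet n → Arcs n → Set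
IsTLBranching D r A L A' =
  IsOutTree D r A' ×
  (∀ v → inV r A' v ≡ true) ×
  (∀ u v → A u v ≡ true → A' u v ≡ true) ×
  (∀ v → L v ≡ true → isLeaf r A' v ≡ true)

IsML : ∀ {n} → Digraph n → Fin n → Arcs n → VSet n → ℕ → Set
IsML D r A L m =
  ((¬ Σ (Arcs _) (IsTLBranching D r A L)) × m ≡ 0)
  ⊎ (Σ (Arcs _) (λ A' → IsTLBranching D r A L A' × leafCount r A' ≡ m)
     × (∀ A' → IsTLBranching D r A L A' → leafCount r A' ≤ m))

Dhat : ∀ {n} → Digraph n → Fin n → Arcs n → VSet n → Arcs n
Dhat D r A L u v = D u v ∧ not (L u) ∧ (A u v ∨ not (inV r A v))

unique? : ∀ {n} → (Fin n → Bool) → Maybe (Fin n)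
unique? {n} f with count f
... | 1 = first f
... | _ = nothing

-- the iterative process defining T^root(x).
-- Arguments: fuel, current tree arcs Acur, arcs added so far Add, current x'.
-- Returns the set of all arcs added.
rootLoop : ∀ {n} → Digraph n → Fin n → VSet n → ℕ → Arcs n → Arcs n → Fin n → Arcs n
rootLoop D r L k Acur Add x' with unique? (Dhat D r Acur L x')
rootLoop D r L (suc k) Acur Add x' | just y =
  rootLoop D r L k (Acur ∪A (λ u v → (u == x') ∧ (v == y)))
                   (Add ∪A (λ u v → (u == x') ∧ (v == y))) y
rootLoop D r L zero Acur Add x' | just y =
  Add ∪A (λ u v → (u == x') ∧ Dhat D r Acur L u v)
rootLoop D r L k Acur Add x' | nothing =
  Add ∪A (λ u v → (u == x') ∧ Dhat D r Acur L u v)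

-- arc set of T^root(x) (an out-tree rooted at x), for T = (r , A).
-- Fuel n suffices: each loop step adds a vertex not yet in the tree.
Troot : ∀ {n} → Digraph n → Fin n → Arcs n → VSet n → Fin n → Arcs n
Troot {n} D r A L x = rootLoop D r L n A (λ _ _ → false) x

-- Fix a (T, L ∪ {x})-out-branching C. Every (T,L)-out-branching B can be transformed,
-- without losing leaves, into a (T, L ∪ {x})-out-branching or, only when T^root(x) has at
-- least two leaves, into a (T ∪ T^root(x), L)-out-branching; both parts follow at once.
-- The transformations re-hang vertices below a new parent, which stays an out-branching as
-- long as no moved vertex is an ancestor of the new parent.
-- Follow the path x = x₀ → x₁ → … traced by T^root(x). Any child of its current end u in B
-- is a D̂-out-neighbour of u. Invariant: if the subtree of B below u uses only arcs of C,
-- then B can be improved as required; at u = x this holds since x is a leaf of C.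
-- While u has a unique D̂-out-neighbour y, either u is a leaf of B (done), or y is its only
-- child; then if y's parent p in C differs from u, re-hang y below p, which makes u a leaf
-- at the cost of at most the leaf p. At the end of the path, if u still has a child in B,
-- re-hang all of its (at least two) D̂-out-neighbours below u.

module Submission where

open import Defs
open import Data.Nat using (ℕ; zero; suc; _+_; _≤_; _⊔_; z≤n; s≤s)
open import Data.Nat.Properties
  using (≤-refl; ≤-trans; ≤-antisym; ≤-pred; ≤-reflexive; n≤1+n; +-monoˡ-≤; +-suc; +-identityʳ; <⇒≱; m≤m⊔n; m≤n⊔m; ⊔-lub)
open import Data.Fin using (Fin; zero; suc; _≟_)
open import Data.Fin.Properties using (suc-injective)
open import Data.Bool using (true; false; _∧_; _∨_; not; if_then_else_)
open import Data.Bool.Properties using (∧-conicalˡ; ∧-conicalʳ; ∨-conicalˡ)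
open import Data.Maybe using (just; nothing)
open import Data.Product using (Σ; _×_; _,_; proj₁; proj₂)
open import Data.Sum using (_⊎_; inj₁; inj₂; [_,_])
open import Data.Empty using (⊥; ⊥-elim)
open import Relation.Nullary using (¬_; yes; no)
open import Relation.Nullary.Decidable using (isYes≗does; dec-true; dec-false)
open import Relation.Binary.PropositionalEquality using (_≡_; refl; sym; trans; subst; _≢_)

true≢false : ∀ {b} → b ≡ true → b ≡ false → ⊥
true≢false refl ()

≢true⇒≡false : ∀ {b} → b ≢ true → b ≡ false
≢true⇒≡false {true}  b≢true = ⊥-elim (b≢true refl)
≢true⇒≡false {false} _      = refl

true-or-false : ∀ b → b ≡ true ⊎ b ≡ false
true-or-false true  = inj₁ refl
true-or-false false = inj₂ refl

∨-introˡ : ∀ {a b} → a ≡ true → a ∨ b ≡ true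
∨-introˡ refl = refl

∨-introʳ : ∀ {a b} → b ≡ true → a ∨ b ≡ true
∨-introʳ {true}  _ = refl
∨-introʳ {false} e = e

∨-elim : ∀ {a b} → a ∨ b ≡ true → a ≡ true ⊎ b ≡ true
∨-elim {true}  _ = inj₁ refl
∨-elim {false} e = inj₂ e

∧-intro : ∀ {a b} → a ≡ true → b ≡ true → a ∧ b ≡ true
∧-intro refl refl = refl

∧-elimˡ : ∀ {a b} → a ∧ b ≡ true → a ≡ true
∧-elimˡ = ∧-conicalˡ _ _

∧-elimʳ : ∀ {a b} → a ∧ b ≡ true → b ≡ true
∧-elimʳ = ∧-conicalʳ _ _

not≡true⇒≡false : ∀ {a} → not a ≡ true → a ≡ false
not≡true⇒≡false {false} _ = refl

≡false⇒not≡true : ∀ {a} → a ≡ false → not a ≡ true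
≡false⇒not≡true refl = refl

==-refl : ∀ {n} (i : Fin n) → (i == i) ≡ true
==-refl i = trans (isYes≗does (i ≟ i)) (dec-true (i ≟ i) refl)

≢⇒==false : ∀ {n} {i j : Fin n} → i ≢ j → (i == j) ≡ false
≢⇒==false {i = i} {j} i≢j = trans (isYes≗does (i ≟ j)) (dec-false (i ≟ j) i≢j)

==⇒≡ : ∀ {n} {i j : Fin n} → (i == j) ≡ true → i ≡ j
==⇒≡ {i = i} {j} e with i ≟ j
... | yes i≡j = i≡j
==⇒≡ {i = i} {j} () | no _

_⊆_ : ∀ {n} → VSet n → VSet n → Set
f ⊆ g = ∀ i → f i ≡ true → g i ≡ true

anyF-true : ∀ {n} (f : VSet n) i → f i ≡ true → anyF f ≡ true
anyF-true f zero    e = ∨-introˡ e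
anyF-true f (suc i) e = ∨-introʳ (anyF-true (λ j → f (suc j)) i e)

anyF-witness : ∀ {n} (f : VSet n) → anyF f ≡ true → Σ (Fin n) (λ i → f i ≡ true)
anyF-witness {suc n} f e with ∨-elim {f zero} e
... | inj₁ f0 = zero , f0
... | inj₂ rest with anyF-witness (λ j → f (suc j)) rest
... | i , fi = suc i , fi

anyF-false : ∀ {n} (f : VSet n) → anyF f ≡ false → ∀ i → f i ≡ false
anyF-false f none i = ≢true⇒≡false (λ fi → true≢false (anyF-true f i fi) none)

anyF-none : ∀ {n} (f : VSet n) → (∀ i → f i ≡ false) → anyF f ≡ false
anyF-none f none = ≢true⇒≡false (λ e → let i , fi = anyF-witness f e in true≢false fi (none i))

count-tail≤ : ∀ {n} (f : VSet (suc n)) → count (λ i → f (suc i)) ≤ count f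
count-tail≤ f with f zero
... | true  = n≤1+n _
... | false = ≤-refl

count-mono : ∀ {n} {f g : VSet n} → f ⊆ g → count f ≤ count g
count-mono {zero}          f⊆g = z≤n
count-mono {suc n} {f} {g} f⊆g with f zero in f0
... | true rewrite f⊆g zero f0 = s≤s (count-mono (λ i → f⊆g (suc i)))
... | false = ≤-trans (count-mono (λ i → f⊆g (suc i))) (count-tail≤ g)

count-mono-< : ∀ {n} {f g : VSet n} → f ⊆ g → ∀ q → f q ≡ false → g q ≡ true → suc (count f) ≤ count g
count-mono-< {suc n} {f} {g} f⊆g zero fq gq rewrite fq | gq = s≤s (count-mono (λ i → f⊆g (suc i)))
count-mono-< {suc n} {f} {g} f⊆g (suc q) fq gq with f zero in f0
... | true rewrite f⊆g zero f0 = s≤s (count-mono-< (λ i → f⊆g (suc i)) q fq gq)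
... | false = ≤-trans (count-mono-< (λ i → f⊆g (suc i)) q fq gq) (count-tail≤ g)

count-⊆-insert : ∀ {n} {f g : VSet n} p → (∀ v → f v ≡ true → v ≢ p → g v ≡ true) → count f ≤ suc (count g)
count-⊆-insert {suc n} {f} {g} zero f⊆g+p with f zero
... | true  = s≤s (≤-trans (count-mono (λ i fi → f⊆g+p (suc i) fi λ ())) (count-tail≤ g))
... | false = ≤-trans (count-mono (λ i fi → f⊆g+p (suc i) fi λ ())) (≤-trans (count-tail≤ g) (n≤1+n _))
count-⊆-insert {suc n} {f} {g} (suc p) f⊆g+p with f zero in f0
... | true rewrite f⊆g+p zero f0 (λ ()) = s≤s (count-⊆-insert p (λ v fv v≢p → f⊆g+p (suc v) fv (λ e → v≢p (suc-injective e))))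
... | false = ≤-trans (count-⊆-insert p (λ v fv v≢p → f⊆g+p (suc v) fv (λ e → v≢p (suc-injective e)))) (s≤s (count-tail≤ g))

count-exchange : ∀ {n} {f g : VSet n} p q → (∀ v → f v ≡ true → v ≢ p → g v ≡ true) → f q ≡ false → g q ≡ true →
                 count f ≤ count g
count-exchange {f = f} {g} p q f⊆g+p fq gq =
  ≤-pred (≤-trans (count-mono-< (λ v fv → ∨-introˡ fv) q fq (∨-introʳ (==-refl q)))
                  (count-⊆-insert p f+q⊆g+p))
  where
  f+q⊆g+p : ∀ v → (f v ∨ (v == q)) ≡ true → v ≢ p → g v ≡ true
  f+q⊆g+p v e v≢p = [ (λ fv → f⊆g+p v fv v≢p) , (λ v=q → subst (λ z → g z ≡ true) (sym (==⇒≡ v=q)) gq) ] (∨-elim {f v} e)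

count≤n : ∀ {n} (f : VSet n) → count f ≤ n
count≤n {zero}  f = z≤n
count≤n {suc n} f with f zero
... | true  = s≤s (count≤n (λ i → f (suc i)))
... | false = ≤-trans (count≤n (λ i → f (suc i))) (n≤1+n n)

count≥1 : ∀ {n} {f : VSet n} i → f i ≡ true → 1 ≤ count f
count≥1 i fi = ≤-trans (s≤s z≤n) (count-mono-< {f = λ _ → false} (λ _ ()) i refl fi)

count≥2 : ∀ {n} {f : VSet n} i j → f i ≡ true → f j ≡ true → i ≢ j → 2 ≤ count f
count≥2 {f = f} i j fi fj i≢j =
  ≤-trans (s≤s (count≥1 i (==-refl i)))
          (count-mono-< (λ v v=i → subst (λ z → f z ≡ true) (sym (==⇒≡ v=i)) fi) j (≢⇒==false (λ e → i≢j (sym e))) fj)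

first-nothing : ∀ {n} (f : VSet n) → first f ≡ nothing → ∀ i → f i ≡ false
first-nothing {suc n} f e i with f zero in f0
first-nothing {suc n} f () i | true
first-nothing {suc n} f e i | false with first (λ j → f (suc j)) in rest
first-nothing {suc n} f e zero    | false | nothing = f0
first-nothing {suc n} f e (suc i) | false | nothing = first-nothing (λ j → f (suc j)) rest i
first-nothing {suc n} f () i      | false | just _

first-just : ∀ {n} (f : VSet n) {y} → first f ≡ just y → f y ≡ true
first-just {suc n} f e with f zero in f0
first-just {suc n} f refl | true = f0
first-just {suc n} f e | false with first (λ j → f (suc j)) in rest
first-just {suc n} f () | false | nothing
first-just {suc n} f refl | false | just z = first-just (λ j → f (suc j)) rest

unique?-just : ∀ {n} (f : VSet n) {y} → unique? f ≡ just y → f y ≡ true × (∀ z → f z ≡ true → z ≡ y)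
unique?-just f {y} e with count f in c
... | 1 = fy , only-y
  where
  fy : f y ≡ true
  fy = first-just f e
  only-y : ∀ z → f z ≡ true → z ≡ y
  only-y z fz with z ≟ y
  ... | yes z≡y = z≡y
  ... | no z≢y with subst (2 ≤_) c (count≥2 z y fz fy z≢y)
  ... | s≤s ()
unique?-just f () | zero
unique?-just f () | suc (suc _)

unique?-nothing : ∀ {n} (f : VSet n) w → f w ≡ true → unique? f ≡ nothing → 2 ≤ count f
unique?-nothing f w fw e with count f in c
... | zero with subst (1 ≤_) c (count≥1 w fw)
... | ()
unique?-nothing f w fw e | 1 = ⊥-elim (true≢false fw (first-nothing f e w))
unique?-nothing f w fw e | suc (suc _) = s≤s (s≤s z≤n)

_⊆A_ : ∀ {n} → Arcs n → Arcs n → Set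
A ⊆A B = ∀ u v → A u v ≡ true → B u v ≡ true

module _ {n : ℕ} (r : Fin n) where

  inV-cases : ∀ (A : Arcs n) {v} → inV r A v ≡ true → v ≡ r ⊎ Σ (Fin n) (λ u → A u v ≡ true)
  inV-cases A {v} e with ∨-elim {v == r} e
  ... | inj₁ v=r = inj₁ (==⇒≡ v=r)
  ... | inj₂ arc = inj₂ (anyF-witness (λ u → A u v) arc)

  inV-head : ∀ (A : Arcs n) {u v} → A u v ≡ true → inV r A v ≡ true
  inV-head A {u} {v} a = ∨-introʳ {v == r} (anyF-true (λ u → A u v) u a)

  inV-root : ∀ (A : Arcs n) → inV r A r ≡ true
  inV-root A = ∨-introˡ (==-refl r)

  inV-mono : ∀ {A A' : Arcs n} → A ⊆A A' → inV r A ⊆ inV r A'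
  inV-mono {A} {A'} A⊆A' v e with inV-cases A e
  ... | inj₁ refl    = inV-root A'
  ... | inj₂ (u , a) = inV-head A' (A⊆A' u v a)

  isLeaf-inV : ∀ (B : Arcs n) {v} → isLeaf r B v ≡ true → inV r B v ≡ true
  isLeaf-inV B = ∧-elimˡ

  isLeaf-sink : ∀ (B : Arcs n) {v} → isLeaf r B v ≡ true → anyF (B v) ≡ false
  isLeaf-sink B {v} l = not≡true⇒≡false (∧-elimʳ {inV r B v} l)

  isLeaf-intro : ∀ (B : Arcs n) {v} → inV r B v ≡ true → anyF (B v) ≡ false → isLeaf r B v ≡ true
  isLeaf-intro B v∈B sink = ∧-intro v∈B (≡false⇒not≡true sink)

  out-arc⇒¬isLeaf : ∀ (B : Arcs n) {v w} → B v w ≡ true → isLeaf r B v ≡ false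
  out-arc⇒¬isLeaf B {v} {w} b = ≢true⇒≡false (λ l → true≢false (anyF-true (B v) w b) (isLeaf-sink B l))

  out-arc⇒∉L : ∀ (B : Arcs n) {L : VSet n} → (∀ v → L v ≡ true → isLeaf r B v ≡ true) →
               ∀ {u w} → B u w ≡ true → L u ≡ false
  out-arc⇒∉L B L-leaves {u} b = ≢true⇒≡false (λ lu → true≢false (L-leaves u lu) (out-arc⇒¬isLeaf B b))

  Reach⇒inV : ∀ {A : Arcs n} {v} → Reach A r v → inV r A v ≡ true
  Reach⇒inV {A} here       = inV-root A
  Reach⇒inV {A} (step _ a) = inV-head A a

module _ {n : ℕ} {D : Digraph n} {r : Fin n} {A : Arcs n} (T : IsOutTree D r A) where

  inV⇒Reach : ∀ {v} → inV r A v ≡ true → Reach A r v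
  inV⇒Reach e with inV-cases r A e
  ... | inj₁ refl    = here
  ... | inj₂ (u , a) = step (IsOutTree.reach T u _ a) a

  inV-tail : ∀ {u v} → A u v ≡ true → inV r A u ≡ true
  inV-tail a = Reach⇒inV r (IsOutTree.reach T _ _ a)

Reach-mono : ∀ {n} {A A' : Arcs n} {a v} → A ⊆A A' → Reach A a v → Reach A' a v
Reach-mono A⊆A' here       = here
Reach-mono A⊆A' (step p a) = step (Reach-mono A⊆A' p) (A⊆A' _ _ a)

Reach-trans : ∀ {n} {A : Arcs n} {a b c} → Reach A a b → Reach A b c → Reach A a c
Reach-trans p here       = p
Reach-trans p (step q a) = step (Reach-trans p q) a

Reach-cons : ∀ {n} {A : Arcs n} {a b c} → A a b ≡ true → Reach A b c →
             Σ (Fin n) (λ c' → Reach A a c' × A c' c ≡ true)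
Reach-cons {a = a} ab here = a , here , ab
Reach-cons ab (step p a)   = _ , Reach-trans (step here ab) p , a

-- Induction on the path from r: y z must be the last arc u z of that path, so rotating
-- the cycle gives one through u, which is closer to the root.
Reach-no-cycle : ∀ {n} {D : Digraph n} {r C} → IsOutTree D r C → ∀ {z} → Reach C r z → ∀ y → Reach C z y → C y z ≡ true → ⊥
Reach-no-cycle T here y _ yz = true≢false yz (IsOutTree.root-in T y)
Reach-no-cycle T (step {u} p uz) y zy yz with IsOutTree.in-unique T y u _ yz uz
... | refl with Reach-cons uz zy
... | c' , uc' , c'u = Reach-no-cycle T p c' uc' c'u

Reach-from-sink : ∀ {n} {B : Arcs n} {u q} → anyF (B u) ≡ false → Reach B u q → q ≡ u
Reach-from-sink sink here = refl
Reach-from-sink {B = B} {u} sink (step p a) with Reach-from-sink sink p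
... | refl = ⊥-elim (true≢false a (anyF-false (B u) sink _))

Reach-via-only-child : ∀ {n} {B : Arcs n} {u y q} → (∀ w → B u w ≡ true → w ≡ y) → Reach B u q → q ≡ u ⊎ Reach B y q
Reach-via-only-child only-y here = inj₁ refl
Reach-via-only-child only-y (step p a) with Reach-via-only-child only-y p
... | inj₂ yq = inj₂ (step yq a)
... | inj₁ refl with only-y _ a
... | refl = inj₂ here

Reach-transfer : ∀ {n} {B C : Arcs n} {u q} → (∀ a b → B a b ≡ true → Reach B u a → C a b ≡ true) → Reach B u q → Reach C u q
Reach-transfer B⊆C here       = here
Reach-transfer B⊆C (step p a) = step (Reach-transfer B⊆C p) (B⊆C _ _ a p)

inV-ancestor : ∀ {n} {D : Digraph n} {r A B} → IsOutTree D r A → IsOutTree D r B → A ⊆A B →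
               ∀ {s v} → Reach B s v → inV r A v ≡ true → inV r A s ≡ true
inV-ancestor TA TB A⊆B here v∈A = v∈A
inV-ancestor {r = r} {A} TA TB A⊆B (step {u} p b) v∈A with inV-cases r A v∈A
... | inj₁ refl = ⊥-elim (true≢false b (IsOutTree.root-in TB u))
... | inj₂ (u' , a) with IsOutTree.in-unique TB u' u _ (A⊆B _ _ a) b
... | refl = inV-ancestor TA TB A⊆B p (inV-tail TA a)


addArc : ∀ {n} → Arcs n → Fin n → Fin n → Arcs n
addArc A u v = A ∪A (λ a b → (a == u) ∧ (b == v))

module _ {n : ℕ} {A : Arcs n} {u v : Fin n} where

  addArc-old : A ⊆A addArc A u v
  addArc-old _ _ = ∨-introˡ

  addArc-new : addArc A u v u v ≡ true
  addArc-new = ∨-introʳ {A u v} (∧-intro (==-refl u) (==-refl v))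

  addArc-cases : ∀ {a b} → addArc A u v a b ≡ true → A a b ≡ true ⊎ (a ≡ u × b ≡ v)
  addArc-cases {a} {b} e with ∨-elim {A a b} e
  ... | inj₁ old = inj₁ old
  ... | inj₂ new = inj₂ (==⇒≡ (∧-elimˡ new) , ==⇒≡ (∧-elimʳ {a == u} new))

  module _ {D : Digraph n} {r : Fin n} (T : IsOutTree D r A)
           (u∈A : inV r A u ≡ true) (v∉A : inV r A v ≡ false) where

    addArc-isOutTree : D u v ≡ true → IsOutTree D r (addArc A u v)
    addArc-isOutTree uv∈D = record
      { sub = sub ; root-in = λ a → ≢true⇒≡false (root-in a) ; in-unique = in-unique ; reach = reach }
      where
      sub : ∀ a b → addArc A u v a b ≡ true → D a b ≡ true
      sub a b e with addArc-cases e
      ... | inj₁ ab          = IsOutTree.sub T a b ab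
      ... | inj₂ (refl , refl) = uv∈D
      root-in : ∀ a → addArc A u v a r ≢ true
      root-in a e with addArc-cases e
      ... | inj₁ ar       = true≢false ar (IsOutTree.root-in T a)
      ... | inj₂ (_ , refl) = true≢false (inV-root r A) v∉A
      in-unique : ∀ a a' b → addArc A u v a b ≡ true → addArc A u v a' b ≡ true → a ≡ a'
      in-unique a a' b e e' with addArc-cases e | addArc-cases e'
      ... | inj₁ ab         | inj₁ a'b        = IsOutTree.in-unique T a a' b ab a'b
      ... | inj₁ ab         | inj₂ (_ , refl) = ⊥-elim (true≢false (inV-head r A ab) v∉A)
      ... | inj₂ (_ , refl) | inj₁ a'b        = ⊥-elim (true≢false (inV-head r A a'b) v∉A)
      ... | inj₂ (refl , _) | inj₂ (refl , _) = refl
      reach : ∀ a b → addArc A u v a b ≡ true → Reach (addArc A u v) r a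
      reach a b e with addArc-cases e
      ... | inj₁ ab         = Reach-mono addArc-old (IsOutTree.reach T a b ab)
      ... | inj₂ (refl , _) = Reach-mono addArc-old (inV⇒Reach T u∈A)

    addArc-isLeaf : isLeaf r (addArc A u v) v ≡ true
    addArc-isLeaf = isLeaf-intro r (addArc A u v) (inV-head r (addArc A u v) addArc-new) (anyF-none _ λ w → ≢true⇒≡false (no-out w))
      where
      no-out : ∀ w → addArc A u v v w ≢ true
      no-out w e with addArc-cases e
      ... | inj₁ vw         = true≢false (inV-tail T vw) v∉A
      ... | inj₂ (refl , _) = true≢false u∈A v∉A

    addArc-grows : suc (count (inV r A)) ≤ count (inV r (addArc A u v))
    addArc-grows = count-mono-< (inV-mono r addArc-old) v v∉A (inV-head r (addArc A u v) addArc-new)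

rewire : ∀ {n} → Arcs n → VSet n → Fin n → Arcs n
rewire B S p u v = if S v then (u == p) else B u v

module _ {n : ℕ} (B : Arcs n) (S : VSet n) (p : Fin n) where

  rewire-moved : ∀ u v → S v ≡ true → rewire B S p u v ≡ (u == p)
  rewire-moved u v sv rewrite sv = refl

  rewire-kept : ∀ u v → S v ≡ false → rewire B S p u v ≡ B u v
  rewire-kept u v sv rewrite sv = refl

module Rewiring {n : ℕ} (D : Digraph n) (r : Fin n) (B : Arcs n) (S : VSet n) (p : Fin n)
                (TB : IsOutTree D r B) (spanning : ∀ v → inV r B v ≡ true)
                (S-not-above-p : ∀ s → S s ≡ true → ¬ Reach B s p) where

  B′ : Arcs n
  B′ = rewire B S p

  private
    moved : ∀ {u v} → S v ≡ true → B′ u v ≡ true → u ≡ p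
    moved {u} {v} sv e = ==⇒≡ (trans (sym (rewire-moved B S p u v sv)) e)

    kept : ∀ {u v} → S v ≡ false → B′ u v ≡ true → B u v ≡ true
    kept {u} {v} sv e = trans (sym (rewire-kept B S p u v sv)) e

    Reach-avoiding : ∀ {v} → Reach B r v → (∀ s → S s ≡ true → ¬ Reach B s v) → Reach B′ r v
    Reach-avoiding here _ = here
    Reach-avoiding (step {u} {v} P a) avoid with true-or-false (S v)
    ... | inj₁ sv = ⊥-elim (avoid v sv here)
    ... | inj₂ sv = step (Reach-avoiding P λ s ss R → avoid s ss (step R a)) (trans (rewire-kept B S p u v sv) a)

  Reach-rewire : ∀ {v} → Reach B r v → Reach B′ r v
  Reach-rewire here = here
  Reach-rewire (step {u} {v} P a) with true-or-false (S v)
  ... | inj₁ sv = step (Reach-avoiding (inV⇒Reach TB (spanning p)) S-not-above-p) (trans (rewire-moved B S p p v sv) (==-refl p))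
  ... | inj₂ sv = step (Reach-rewire P) (trans (rewire-kept B S p u v sv) a)

  rewire-spanning : ∀ v → inV r B′ v ≡ true
  rewire-spanning v = Reach⇒inV r (Reach-rewire (inV⇒Reach TB (spanning v)))

  rewire-isOutTree : (∀ v → S v ≡ true → D p v ≡ true) → S r ≡ false → IsOutTree D r B′
  rewire-isOutTree pS⊆D Sr = record
    { sub = sub ; root-in = λ u → trans (rewire-kept B S p u r Sr) (IsOutTree.root-in TB u)
    ; in-unique = in-unique ; reach = λ u _ _ → Reach-rewire (inV⇒Reach TB (spanning u)) }
    where
    sub : ∀ u v → B′ u v ≡ true → D u v ≡ true
    sub u v e with true-or-false (S v)
    ... | inj₁ sv rewrite moved sv e = pS⊆D v sv
    ... | inj₂ sv = IsOutTree.sub TB u v (kept sv e)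
    in-unique : ∀ u u' v → B′ u v ≡ true → B′ u' v ≡ true → u ≡ u'
    in-unique u u' v e e' with true-or-false (S v)
    ... | inj₁ sv = trans (moved sv e) (sym (moved sv e'))
    ... | inj₂ sv = IsOutTree.in-unique TB u u' v (kept sv e) (kept sv e')

  rewire-⊇ : ∀ {A : Arcs n} → A ⊆A B → (∀ v → S v ≡ true → inV r A v ≡ false) → A ⊆A B′
  rewire-⊇ {A} A⊆B S∩A=∅ u v a with true-or-false (S v)
  ... | inj₁ sv = ⊥-elim (true≢false (inV-head r A a) (S∩A=∅ v sv))
  ... | inj₂ sv = trans (rewire-kept B S p u v sv) (A⊆B u v a)

  rewire-sink : ∀ v → v ≢ p → (∀ u → B v u ≡ true → S u ≡ true) → anyF (B′ v) ≡ false
  rewire-sink v v≢p children-move = anyF-none (B′ v) no-child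
    where
    no-child : ∀ u → B′ v u ≡ false
    no-child u with true-or-false (S u)
    ... | inj₁ su = trans (rewire-moved B S p v u su) (≢⇒==false v≢p)
    ... | inj₂ su = trans (rewire-kept B S p v u su) (≢true⇒≡false λ vu → true≢false (children-move u vu) su)

  rewire-isLeaf : ∀ v → v ≢ p → isLeaf r B v ≡ true → isLeaf r B′ v ≡ true
  rewire-isLeaf v v≢p l =
    isLeaf-intro r B′ (rewire-spanning v) (rewire-sink v v≢p λ u vu → ⊥-elim (true≢false vu (anyF-false (B v) (isLeaf-sink r B l) u)))

  rewire-branching : ∀ {A : Arcs n} {L : VSet n} → IsTLBranching D r A L B →
                     (∀ v → S v ≡ true → D p v ≡ true) → (∀ v → S v ≡ true → inV r A v ≡ false) → L p ≡ false →
                     IsTLBranching D r A L B′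
  rewire-branching {A} {L} (_ , _ , A⊆B , L-leaves) pS⊆D S∩A=∅ Lp =
    rewire-isOutTree pS⊆D (≢true⇒≡false λ sr → true≢false (inV-root r A) (S∩A=∅ r sr)) , rewire-spanning , rewire-⊇ A⊆B S∩A=∅ ,
    λ v lv → rewire-isLeaf v (λ v≡p → true≢false lv (subst (λ z → L z ≡ false) (sym v≡p) Lp)) (L-leaves v lv)

module _ {n : ℕ} {D : Digraph n} {r : Fin n} where

  IsTLBranching-weakenL : ∀ {A L L' B} → L ⊆ L' → IsTLBranching D r A L' B → IsTLBranching D r A L B
  IsTLBranching-weakenL L⊆L' (T , span , A⊆B , L'-leaves) = T , span , A⊆B , λ v lv → L'-leaves v (L⊆L' v lv)

  IsTLBranching-weakenA : ∀ {A A' L B} → A ⊆A A' → IsTLBranching D r A' L B → IsTLBranching D r A L B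
  IsTLBranching-weakenA A⊆A' (T , span , A'⊆B , L-leaves) = T , span , (λ u v a → A'⊆B u v (A⊆A' u v a)) , L-leaves

module DhatProperties {n : ℕ} (D : Digraph n) (r : Fin n) (L : VSet n) where

  Dhat-⊆ : ∀ Acur {u w} → Dhat D r Acur L u w ≡ true → D u w ≡ true
  Dhat-⊆ _ = ∧-elimˡ

  Dhat-leaves-tree : ∀ Acur {u w} → isLeaf r Acur u ≡ true → Dhat D r Acur L u w ≡ true → inV r Acur w ≡ false
  Dhat-leaves-tree Acur {u} {w} u-leaf d with ∨-elim {Acur u w} (∧-elimʳ {not (L u)} (∧-elimʳ {D u w} d))
  ... | inj₁ a     = ⊥-elim (true≢false (anyF-true (Acur u) w a) (isLeaf-sink r Acur u-leaf))
  ... | inj₂ w∉Acur = not≡true⇒≡false w∉Acur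

  branching-arc-in-Dhat : ∀ Acur {A' B} → IsTLBranching D r A' L B → Acur ⊆A B → ∀ {u w} → B u w ≡ true →
                          Dhat D r Acur L u w ≡ true
  branching-arc-in-Dhat Acur {B = B} (TB , _ , _ , L-leaves) Acur⊆B {u} {w} b =
    ∧-intro (IsOutTree.sub TB u w b) (∧-intro (≡false⇒not≡true (out-arc⇒∉L r B L-leaves b)) tree-arc-or-new)
    where
    tree-arc-or-new : (Acur u w ∨ not (inV r Acur w)) ≡ true
    tree-arc-or-new with true-or-false (inV r Acur w)
    ... | inj₂ w∉Acur = ∨-introʳ {Acur u w} (≡false⇒not≡true w∉Acur)
    ... | inj₁ w∈Acur with inV-cases r Acur w∈Acur
    ... | inj₁ refl    = ⊥-elim (true≢false b (IsOutTree.root-in TB u))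
    ... | inj₂ (u' , a) with IsOutTree.in-unique TB u' u w (Acur⊆B u' w a) b
    ... | refl = ∨-introˡ a

  Dhat-star-isLeaf : ∀ Acur {Add u v} (x : Fin n) → IsOutTree D r Acur → Add ⊆A Acur → isLeaf r Acur u ≡ true →
                     Dhat D r Acur L u v ≡ true → isLeaf x (Add ∪A (λ a b → (a == u) ∧ Dhat D r Acur L a b)) v ≡ true
  Dhat-star-isLeaf Acur {Add} {u} {v} x TAcur Add⊆Acur u-leaf uv =
    isLeaf-intro x R (inV-head x R (∨-introʳ {Add u v} (∧-intro (==-refl u) uv))) (anyF-none (R v) λ w → ≢true⇒≡false (no-out w))
    where
    R : Arcs n
    R = Add ∪A (λ a b → (a == u) ∧ Dhat D r Acur L a b)
    v∉Acur : inV r Acur v ≡ false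
    v∉Acur = Dhat-leaves-tree Acur u-leaf uv
    no-out : ∀ w → R v w ≢ true
    no-out w e with ∨-elim {Add v w} e
    ... | inj₁ vw   = true≢false (inV-tail TAcur (Add⊆Acur v w vw)) v∉Acur
    ... | inj₂ star = true≢false (isLeaf-inV r Acur u-leaf) (subst (λ z → inV r Acur z ≡ false) (==⇒≡ (∧-elimˡ star)) v∉Acur)

module Exchange {n : ℕ} (D : Digraph n) (r : Fin n) (A : Arcs n) (TA : IsOutTree D r A)
                (L : VSet n) (x : Fin n) (x-leaf : isLeaf r A x ≡ true)
                (C : Arcs n) (C-branching : IsTLBranching D r A (L ∪｛ x ｝) C) where

  open DhatProperties D r L

  Branching : Arcs n → Set
  Branching = IsTLBranching D r A L

  BranchingX : Arcs n → Set
  BranchingX = IsTLBranching D r A (L ∪｛ x ｝)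

  private
    TC : IsOutTree D r C
    TC = proj₁ C-branching

    C-spanning : ∀ v → inV r C v ≡ true
    C-spanning = proj₁ (proj₂ C-branching)

  SubtreeInC : Arcs n → Fin n → Set
  SubtreeInC B u = ∀ q w → B q w ≡ true → Reach B u q → C q w ≡ true

  sink-SubtreeInC : ∀ {B u} → anyF (B u) ≡ false → SubtreeInC B u
  sink-SubtreeInC {B} {u} sink q w b R with Reach-from-sink sink R
  ... | refl = ⊥-elim (true≢false b (anyF-false (B u) sink w))

  Improvable : Arcs n → Fin n → Set
  Improvable Acur u = ∀ B → Branching B → Acur ⊆A B → SubtreeInC B u →
                      Σ (Arcs n) (λ B′ → leafCount r B ≤ leafCount r B′ × BranchingX B′)

  -- x is a leaf of C, so a B-subtree below x inside C is just x.
  improvable-at-x : Improvable A x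
  improvable-at-x B (TB , B-spanning , A⊆B , L-leaves) _ subtree =
    B , ≤-refl , (TB , B-spanning , A⊆B , L+x-leaves)
    where
    x-sink-in-C : anyF (C x) ≡ false
    x-sink-in-C = isLeaf-sink r C (proj₂ (proj₂ (proj₂ C-branching)) x (∨-introʳ {L x} (==-refl x)))
    L+x-leaves : ∀ v → (L ∪｛ x ｝) v ≡ true → isLeaf r B v ≡ true
    L+x-leaves v e with ∨-elim {L v} e
    ... | inj₁ lv  = L-leaves v lv
    ... | inj₂ v=x rewrite ==⇒≡ v=x =
      isLeaf-intro r B (B-spanning x)
        (anyF-none (B x) λ w → ≢true⇒≡false λ xw → true≢false (subtree x w xw here) (anyF-false (C x) x-sink-in-C w))

  -- This turns u into a leaf and costs at most the leaf p.
  reattach-to-C-parent : ∀ {Acur u y p B} → A ⊆A Acur → Acur ⊆A B → inV r Acur y ≡ false → Improvable Acur u →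
                         Branching B → (∀ w → B u w ≡ true → w ≡ y) → B u y ≡ true → SubtreeInC B y →
                         C p y ≡ true → p ≢ u → Σ (Arcs n) (λ B″ → leafCount r B ≤ leafCount r B″ × BranchingX B″)
  reattach-to-C-parent {Acur} {u} {y} {p} {B} A⊆Acur Acur⊆B y∉Acur improvable B-branching only-y uy subtree py p≢u =
    proj₁ improved , ≤-trans fewer-lost (proj₁ (proj₂ improved)) , proj₂ (proj₂ improved)
    where
    S : VSet n
    S v = v == y
    y-not-above-p : ∀ s → S s ≡ true → ¬ Reach B s p
    y-not-above-p s s=y R rewrite ==⇒≡ s=y =
      Reach-no-cycle TC (inV⇒Reach TC (C-spanning y)) p (Reach-transfer subtree R) py
    open Rewiring D r B S p (proj₁ B-branching) (proj₁ (proj₂ B-branching)) y-not-above-p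
    S∩Acur=∅ : ∀ v → S v ≡ true → inV r Acur v ≡ false
    S∩Acur=∅ v v=y rewrite ==⇒≡ v=y = y∉Acur
    B′-branching : Branching B′
    B′-branching = rewire-branching B-branching
      (λ v v=y → subst (λ z → D p z ≡ true) (sym (==⇒≡ v=y)) (IsOutTree.sub TC p y py))
      (λ v v=y → ≢true⇒≡false λ v∈A → true≢false (inV-mono r A⊆Acur v v∈A) (S∩Acur=∅ v v=y))
      (∨-conicalˡ _ _ (out-arc⇒∉L r C (proj₂ (proj₂ (proj₂ C-branching))) py))
    Acur⊆B′ : Acur ⊆A B′
    Acur⊆B′ = rewire-⊇ Acur⊆B S∩Acur=∅
    u-sink : anyF (B′ u) ≡ false
    u-sink = rewire-sink u (λ u≡p → p≢u (sym u≡p)) λ w uw → subst (λ z → (z == y) ≡ true) (sym (only-y w uw)) (==-refl y)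
    fewer-lost : leafCount r B ≤ leafCount r B′
    fewer-lost = count-exchange p u (λ v l v≢p → rewire-isLeaf v v≢p l) (out-arc⇒¬isLeaf r B uy)
                   (isLeaf-intro r B′ (rewire-spanning u) u-sink)
    improved : Σ (Arcs n) (λ B″ → leafCount r B′ ≤ leafCount r B″ × BranchingX B″)
    improved = improvable B′ B′-branching Acur⊆B′ (sink-SubtreeInC u-sink)

  improvable-step : ∀ {Acur u y} → A ⊆A Acur → isLeaf r Acur u ≡ true → Improvable Acur u →
                    (∀ z → Dhat D r Acur L u z ≡ true → z ≡ y) → Dhat D r Acur L u y ≡ true →
                    Improvable (addArc Acur u y) y
  improvable-step {Acur} {u} {y} A⊆Acur u-leaf improvable only-y uy B B-branching Acur+uy⊆B subtree =
    via-C-parent (inV-cases r C (C-spanning y))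
    where
    y∉Acur : inV r Acur y ≡ false
    y∉Acur = Dhat-leaves-tree Acur u-leaf uy
    Acur⊆B : Acur ⊆A B
    Acur⊆B a b e = Acur+uy⊆B a b (addArc-old {A = Acur} a b e)
    only-child-y : ∀ w → B u w ≡ true → w ≡ y
    only-child-y w uw = only-y w (branching-arc-in-Dhat Acur B-branching Acur⊆B uw)
    via-C-parent : y ≡ r ⊎ Σ (Fin n) (λ p → C p y ≡ true) →
                   Σ (Arcs n) (λ B′ → leafCount r B ≤ leafCount r B′ × BranchingX B′)
    via-C-parent (inj₁ y≡r) = ⊥-elim (true≢false (subst (λ z → inV r Acur z ≡ true) (sym y≡r) (inV-root r Acur)) y∉Acur)
    via-C-parent (inj₂ (p , py)) with p ≟ u
    ... | no p≢u = reattach-to-C-parent A⊆Acur Acur⊆B y∉Acur improvable B-branching only-child-y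
                     (Acur+uy⊆B u y (addArc-new {A = Acur})) subtree py p≢u
    ... | yes refl = improvable B B-branching Acur⊆B subtree-at-u
      where
      subtree-at-u : SubtreeInC B u
      subtree-at-u q w qw R with Reach-via-only-child only-child-y R
      ... | inj₂ yq = subtree q w qw yq
      ... | inj₁ refl rewrite only-child-y w qw = py

  -- u is not a leaf of B, so no leaf is lost.
  hang-Dhat-neighbours : ∀ {Acur Add u w B} → IsOutTree D r Acur → A ⊆A Acur → Add ⊆A Acur → isLeaf r Acur u ≡ true →
                         Branching B → Acur ⊆A B → B u w ≡ true →
                         Σ (Arcs n) (λ B′ → leafCount r B ≤ leafCount r B′ ×
                                            IsTLBranching D r (A ∪A (Add ∪A (λ a b → (a == u) ∧ Dhat D r Acur L a b))) L B′)
  hang-Dhat-neighbours {Acur} {Add} {u} {w} {B} TAcur A⊆Acur Add⊆Acur u-leaf B-branching@(TB , B-spanning , _ , L-leaves) Acur⊆B uw =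
    B′ , count-mono kept-leaf , proj₁ B′-branching , proj₁ (proj₂ B′-branching) , A+R⊆B′ , proj₂ (proj₂ (proj₂ B′-branching))
    where
    S : VSet n
    S = Dhat D r Acur L u
    S∩Acur=∅ : ∀ v → S v ≡ true → inV r Acur v ≡ false
    S∩Acur=∅ v = Dhat-leaves-tree Acur u-leaf
    S-not-above-u : ∀ s → S s ≡ true → ¬ Reach B s u
    S-not-above-u s us R = true≢false (inV-ancestor TAcur TB Acur⊆B R (isLeaf-inV r Acur u-leaf)) (S∩Acur=∅ s us)
    open Rewiring D r B S u TB B-spanning S-not-above-u
    B′-branching : Branching B′
    B′-branching = rewire-branching B-branching (λ v → Dhat-⊆ Acur)
                     (λ v uv → ≢true⇒≡false λ v∈A → true≢false (inV-mono r A⊆Acur v v∈A) (S∩Acur=∅ v uv))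
                     (out-arc⇒∉L r B L-leaves uw)
    A+R⊆B′ : (A ∪A (Add ∪A (λ a b → (a == u) ∧ Dhat D r Acur L a b))) ⊆A B′
    A+R⊆B′ a b e with ∨-elim {A a b} e
    ... | inj₁ ab = proj₁ (proj₂ (proj₂ B′-branching)) a b ab
    ... | inj₂ e′ with ∨-elim {Add a b} e′
    ... | inj₁ ab   = rewire-⊇ Acur⊆B S∩Acur=∅ a b (Add⊆Acur a b ab)
    ... | inj₂ star with ==⇒≡ {i = a} {u} (∧-elimˡ star)
    ... | refl = trans (rewire-moved B S u u b (∧-elimʳ {u == u} star)) (==-refl u)
    kept-leaf : ∀ v → isLeaf r B v ≡ true → isLeaf r B′ v ≡ true
    kept-leaf v l = rewire-isLeaf v (λ v≡u → true≢false l (subst (λ z → isLeaf r B z ≡ false) (sym v≡u) (out-arc⇒¬isLeaf r B uw))) l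

  Improved : Arcs n → Arcs n → Set
  Improved R B = Σ (Arcs n) (λ B′ → leafCount r B ≤ leafCount r B′ ×
                   (BranchingX B′ ⊎ (IsTLBranching D r (A ∪A R) L B′ × 2 ≤ leafCount x R)))

  record Invariant (k : ℕ) (Acur Add : Arcs n) (u : Fin n) : Set where
    field
      tree       : IsOutTree D r Acur
      A⊆Acur     : A ⊆A Acur
      Add⊆Acur   : Add ⊆A Acur
      end-leaf   : isLeaf r Acur u ≡ true
      -- each step adds a vertex to Acur, so the fuel k of rootLoop never runs out
      fuel       : suc n ≤ count (inV r Acur) + k
      improvable : Improvable Acur u

  invariant-step : ∀ {k Acur Add u y} → Invariant (suc k) Acur Add u →
                   (∀ z → Dhat D r Acur L u z ≡ true → z ≡ y) → Dhat D r Acur L u y ≡ true →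
                   Invariant k (addArc Acur u y) (addArc Add u y) y
  invariant-step {k} {Acur} {Add} {u} {y} I only-y uy = record
    { tree       = addArc-isOutTree {u = u} {y} tree u∈Acur y∉Acur (Dhat-⊆ Acur uy)
    ; A⊆Acur     = λ a b e → addArc-old {A = Acur} a b (A⊆Acur a b e)
    ; Add⊆Acur   = Add+uy⊆Acur+uy
    ; end-leaf   = addArc-isLeaf {u = u} {y} tree u∈Acur y∉Acur
    ; fuel       = ≤-trans fuel (≤-trans (≤-reflexive (+-suc _ k)) (+-monoˡ-≤ k (addArc-grows {u = u} {y} tree u∈Acur y∉Acur)))
    ; improvable = improvable-step A⊆Acur end-leaf improvable only-y uy
    }
    where
    open Invariant I
    u∈Acur : inV r Acur u ≡ true
    u∈Acur = isLeaf-inV r Acur end-leaf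
    y∉Acur : inV r Acur y ≡ false
    y∉Acur = Dhat-leaves-tree Acur end-leaf uy
    Add+uy⊆Acur+uy : addArc Add u y ⊆A addArc Acur u y
    Add+uy⊆Acur+uy a b e with addArc-cases {A = Add} e
    ... | inj₁ ab            = addArc-old {A = Acur} a b (Add⊆Acur a b ab)
    ... | inj₂ (refl , refl) = addArc-new {A = Acur}

  loop : ∀ k {Acur Add u} → Invariant k Acur Add u → ∀ B → Branching B → Acur ⊆A B → Improved (rootLoop D r L k Acur Add u) B
  loop k {Acur} {Add} {u} I B B-branching Acur⊆B with unique? (Dhat D r Acur L u) in uniq | true-or-false (anyF (B u))
  ... | _ | inj₂ sink =
    let B′ , more , B′-branching = Invariant.improvable I B B-branching Acur⊆B (sink-SubtreeInC sink)
    in B′ , more , inj₁ B′-branching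
  loop zero I B B-branching Acur⊆B | just _ | inj₁ _ =
    ⊥-elim (<⇒≱ (s≤s (count≤n _)) (subst (suc n ≤_) (+-identityʳ _) (Invariant.fuel I)))
  loop (suc k) {Acur} {Add} {u} I B B-branching Acur⊆B | just y | inj₁ has-child =
    loop k (invariant-step I only-y uy) B B-branching Acur+uy⊆B
    where
    only-y : ∀ z → Dhat D r Acur L u z ≡ true → z ≡ y
    only-y = proj₂ (unique?-just _ uniq)
    uy : Dhat D r Acur L u y ≡ true
    uy = proj₁ (unique?-just _ uniq)
    Acur+uy⊆B : addArc Acur u y ⊆A B
    Acur+uy⊆B a b e with addArc-cases {A = Acur} e
    ... | inj₁ ab = Acur⊆B a b ab
    ... | inj₂ (refl , refl) =
      let w , uw = anyF-witness (B u) has-child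
      in subst (λ z → B u z ≡ true) (only-y w (branching-arc-in-Dhat Acur B-branching Acur⊆B uw)) uw
  loop k {Acur} {Add} {u} I B B-branching Acur⊆B | nothing | inj₁ has-child =
    B′ , more , inj₂ (B′-branching , two-leaves)
    where
    open Invariant I
    w-uw = anyF-witness (B u) has-child
    hung = hang-Dhat-neighbours tree A⊆Acur Add⊆Acur end-leaf B-branching Acur⊆B (proj₂ w-uw)
    B′ = proj₁ hung
    more = proj₁ (proj₂ hung)
    B′-branching = proj₂ (proj₂ hung)
    two-leaves : 2 ≤ leafCount x (Add ∪A (λ a b → (a == u) ∧ Dhat D r Acur L a b))
    two-leaves = ≤-trans (unique?-nothing _ (proj₁ w-uw) (branching-arc-in-Dhat Acur B-branching Acur⊆B (proj₂ w-uw)) uniq)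
                         (count-mono (λ v → Dhat-star-isLeaf Acur {v = v} x tree Add⊆Acur end-leaf))

  improve : ∀ B → Branching B → Improved (Troot D r A L x) B
  improve B B-branching = loop n initial B B-branching (proj₁ (proj₂ (proj₂ B-branching)))
    where
    initial : Invariant n A (λ _ _ → false) x
    initial = record
      { tree = TA ; A⊆Acur = λ _ _ a → a ; Add⊆Acur = λ _ _ () ; end-leaf = x-leaf
      ; fuel = +-monoˡ-≤ n (count≥1 x (isLeaf-inV r A x-leaf)) ; improvable = improvable-at-x }

module _ {n : ℕ} {D : Digraph n} {r : Fin n} {A : Arcs n} {L : VSet n} where

  IsML-branching : ∀ {m} → IsML D r A L m → 1 ≤ m → Σ (Arcs n) (IsTLBranching D r A L)
  IsML-branching (inj₁ (_ , refl)) ()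
  IsML-branching (inj₂ ((B , B-branching , _) , _)) _ = B , B-branching

  IsML-upper : ∀ {m B} → IsML D r A L m → IsTLBranching D r A L B → leafCount r B ≤ m
  IsML-upper (inj₁ (none , _))  B-branching = ⊥-elim (none (_ , B-branching))
  IsML-upper (inj₂ (_ , maximal)) B-branching = maximal _ B-branching

  IsML-least : ∀ {m k} → IsML D r A L m → (∀ B → IsTLBranching D r A L B → leafCount r B ≤ k) → m ≤ k
  IsML-least (inj₁ (_ , refl))                  _     = z≤n
  IsML-least (inj₂ ((B , B-branching , refl) , _)) bound = bound B B-branching

lemma5 : ∀ {n} (D : Digraph n) (r : Fin n) (A : Arcs n) → IsOutTree D r A →
    (L : VSet n) → (∀ v → L v ≡ true → inV r A v ≡ true → isLeaf r A v ≡ true) →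
    (x : Fin n) → isLeaf r A x ≡ true → L x ≡ false →
    (mL mLx : ℕ) → IsML D r A L mL → IsML D r A (L ∪｛ x ｝) mLx → 1 ≤ mLx →
    ((2 ≤ leafCount x (Troot D r A L x) →
        ∀ m2 → IsML D r (A ∪A Troot D r A L x) L m2 → mL ≡ mLx ⊔ m2)
     × (leafCount x (Troot D r A L x) ≡ 1 → mL ≡ mLx))
lemma5 D r A TA L _ x x-leaf _ mL mLx ML ML+x 1≤mLx = part-i , part-ii
  where
  C = IsML-branching ML+x 1≤mLx
  open Exchange D r A TA L x x-leaf (proj₁ C) (proj₂ C)
  R = Troot D r A L x
  mLx≤mL : mLx ≤ mL
  mLx≤mL = IsML-least ML+x λ B B-branching → IsML-upper ML (IsTLBranching-weakenL (λ _ → ∨-introˡ) B-branching)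
  part-i : 2 ≤ leafCount x R → ∀ m2 → IsML D r (A ∪A R) L m2 → mL ≡ mLx ⊔ m2
  part-i _ m2 ML+R = ≤-antisym (IsML-least ML bound) (⊔-lub mLx≤mL m2≤mL)
    where
    m2≤mL = IsML-least ML+R λ B B-branching → IsML-upper ML (IsTLBranching-weakenA (λ _ _ → ∨-introˡ) B-branching)
    bound : ∀ B → Branching B → leafCount r B ≤ mLx ⊔ m2
    bound B B-branching with improve B B-branching
    ... | B′ , more , inj₁ B′-branching      = ≤-trans more (≤-trans (IsML-upper ML+x B′-branching) (m≤m⊔n mLx m2))
    ... | B′ , more , inj₂ (B′-branching , _) = ≤-trans more (≤-trans (IsML-upper ML+R B′-branching) (m≤n⊔m mLx m2))
  part-ii : leafCount x R ≡ 1 → mL ≡ mLx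
  part-ii one-leaf = ≤-antisym (IsML-least ML bound) mLx≤mL
    where
    bound : ∀ B → Branching B → leafCount r B ≤ mLx
    bound B B-branching with improve B B-branching
    ... | B′ , more , inj₁ B′-branching = ≤-trans more (IsML-upper ML+x B′-branching)
    ... | _ , _ , inj₂ (_ , two-leaves) with subst (2 ≤_) one-leaf two-leaves
    ... | s≤s ()
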